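{- Define numbers $\delta_{n,p}$ for integers $n,p\ge 0$ by $\delta_{0,p}=p+1$ and $\delta_{n+1,p}=\sum_{i=0}^{n}\delta_{i,p}\,\delta_{n-i,p+i}$ for $n\ge 0$. Then the number of relaxed trees of size $n$ equals $\delta_{n,0}$ for all $n\ge0$.
   Context: A full binary tree is a rooted plane tree in which every node has $0$ or $2$ ordered children. A relaxed tree of size $n\ge0$: take a full binary tree $T$ with $n$ internal nodes and traverse it in post-order (left subtree, right subtree, node). The first leaf visited is kept as the unique sink; every other leaf $\lambda$ is replaced by a pointer to a node $v$ which is either an internal node of $T$ or the sink and is visited before $\lambda$. Two relaxed trees are equal iff they have the same $T$ and the same pointer targets. -}

module Defs where

open import Data.Nat using (ℕ; zero; suc; _+_; _*_; _∸_)
open import Data.Bool using (Bool; true; false; _∨_; not)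
open import Data.List using (List; []; _∷_; _++_; [_]; length; lookup; map; upTo)
open import Data.Nat.ListAction using (sum)
open import Data.Bool.ListAction using (any)
open import Data.Empty using (⊥)
open import Data.Fin using (Fin)
open import Data.Unit using (⊤)
open import Data.Product using (Σ; _×_)
open import Data.Sum using (_⊎_)
open import Relation.Binary.PropositionalEquality using (_≡_)

-- Implemented with a fuel argument (fuel ≥ n is always available), so
-- that the recursion is structural; δ n p = δ-fuel n n p.

δ-fuel : ℕ → ℕ → ℕ → ℕ
δ-fuel _       zero    p = suc p
δ-fuel zero    (suc n) p = 0          -- never reached from δ below
δ-fuel (suc f) (suc n) p =
  sum (map (λ i → δ-fuel f i p * δ-fuel f (n ∸ i) (p + i)) (upTo (suc n)))

δ : ℕ → ℕ → ℕ
δ n p = δ-fuel n n p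

data FBT : Set where
  leaf : FBT
  node : FBT → FBT → FBT

internals : FBT → ℕ
internals leaf       = 0
internals (node l r) = suc (internals l + internals r)

-- post-order traversal (left subtree, right subtree, node);
-- true = internal node, false = leaf
postorder : FBT → List Bool
postorder leaf       = false ∷ []
postorder (node l r) = postorder l ++ postorder r ++ true ∷ []

-- Pointer targets.  `pre` is the list of nodes already visited (in
-- post-order).  A valid target for a (non-first) leaf is a position j in
-- `pre` which is an internal node, or the sink (= the first leaf visited).

IsFirstLeaf : (xs : List Bool) → Fin (length xs) → Set
IsFirstLeaf (false ∷ xs) Fin.zero    = ⊤
IsFirstLeaf (true  ∷ xs) Fin.zero    = ⊥
IsFirstLeaf (false ∷ xs) (Fin.suc j) = ⊥
IsFirstLeaf (true  ∷ xs) (Fin.suc j) = IsFirstLeaf xs j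

Target : List Bool → Set
Target pre = Σ (Fin (length pre)) (λ j → (lookup pre j ≡ true) ⊎ IsFirstLeaf pre j)

hasLeaf : List Bool → Bool
hasLeaf = any not

Pointers : (pre rest : List Bool) → Set
Pointers pre []            = ⊤
Pointers pre (true  ∷ rest) = Pointers (pre ++ [ true ]) rest
Pointers pre (false ∷ rest) with hasLeaf pre
... | false = Pointers (pre ++ [ false ]) rest            -- the sink
... | true  = Target pre × Pointers (pre ++ [ false ]) rest

RelaxedTree : ℕ → Set
RelaxedTree n = Σ FBT (λ T → (internals T ≡ n) × Pointers [] (postorder T))

-- Once the first leaf (the sink) has been visited, a leaf reached after t internal
-- nodes has exactly t + 1 possible targets, so a relaxed tree is a full binary tree
-- whose post-order word is decorated by such choices. Cutting a tree at its root into
-- a left subtree with i internal nodes and a right subtree, the leaves of the right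
-- subtree see i more internal nodes than those of the whole tree; hence the number of
-- decorated trees of size n whose leaves already see p internal nodes satisfies the
-- recursion of δ n p.

module Submission where

open import Defs
open import Data.Bool using (Bool; true; false)
open import Data.Empty using (⊥-elim)
open import Data.Fin as Fin using (Fin)
open import Data.Fin.Properties using (1↔⊤; +↔⊎; *↔×)
open import Data.List using (List; []; _∷_; _++_; [_]; length; lookup; map; applyUpTo)
open import Data.Nat using (ℕ; zero; suc; _+_; _*_; _∸_; _≤_; s≤s)
open import Data.Nat.ListAction using (sum)
open import Data.Nat.Properties
  using (≡-irrelevant; suc-injective; +-suc; +-identityʳ; +-comm; ≤-refl; ≤-trans; ≤-reflexive; m+n≤o⇒m≤o; m+n≤o⇒n≤o)
open import Data.Product using (Σ; _×_; _,_; ∃)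
open import Data.Product.Algebra using (×-cong; Σ-assoc)
open import Data.Product.Function.Dependent.Propositional using () renaming (congˡ to Σ-cong)
open import Data.Sum using (_⊎_; inj₁; inj₂)
open import Data.Sum.Algebra using (⊎-cong)
open import Data.Unit using (⊤; tt)
open import Function.Base using (_∘_)
open import Function.Bundles using (_↔_; mk↔ₛ′)
open import Function.Properties.Inverse using (↔-refl; ↔-sym; ↔-trans)
open import Function.Related.Propositional using (K-reflexive; module EquationalReasoning)
open import Relation.Nullary using (¬_)
open import Relation.Binary.PropositionalEquality using (_≡_; refl; sym; trans; cong; cong₂; module ≡-Reasoning)

private
  variable
    A B : Set
    a b k n t : ℕ

×-⊤↔ : (A × ⊤) ↔ A
×-⊤↔ = mk↔ₛ′ (λ (a , _) → a) (_, tt) (λ _ → refl) (λ _ → refl)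

⊤-×↔ : (⊤ × A) ↔ A
⊤-×↔ = mk↔ₛ′ (λ (_ , a) → a) (tt ,_) (λ _ → refl) (λ _ → refl)

⊎-emptyʳ : ¬ B → (A ⊎ B) ↔ A
⊎-emptyʳ ¬b = mk↔ₛ′ (λ { (inj₁ a) → a ; (inj₂ b) → ⊥-elim (¬b b) }) inj₁ (λ _ → refl)
  (λ { (inj₁ _) → refl ; (inj₂ b) → ⊥-elim (¬b b) })

⊎-emptyˡ : ¬ A → (A ⊎ B) ↔ B
⊎-emptyˡ ¬a = mk↔ₛ′ (λ { (inj₁ a) → ⊥-elim (¬a a) ; (inj₂ b) → b }) inj₂ (λ _ → refl)
  (λ { (inj₁ a) → ⊥-elim (¬a a) ; (inj₂ _) → refl })

true≡true↔⊤ : (true ≡ true) ↔ ⊤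
true≡true↔⊤ = mk↔ₛ′ (λ _ → tt) (λ _ → refl) (λ _ → refl) (λ { refl → refl })

suc≡suc↔ : (suc a ≡ suc b) ↔ (a ≡ b)
suc≡suc↔ = mk↔ₛ′ suc-injective (cong suc) (λ { refl → refl }) (λ { refl → refl })

Fin-suc↔ : Fin (suc k) ↔ (⊤ ⊎ Fin k)
Fin-suc↔ = ↔-trans +↔⊎ (⊎-cong 1↔⊤ ↔-refl)

Σ-Fin-suc↔ : {P : Fin (suc k) → Set} → Σ (Fin (suc k)) P ↔ (P Fin.zero ⊎ Σ (Fin k) (P ∘ Fin.suc))
Σ-Fin-suc↔ = mk↔ₛ′
  (λ { (Fin.zero , p) → inj₁ p ; (Fin.suc i , p) → inj₂ (i , p) })
  (λ { (inj₁ p) → Fin.zero , p ; (inj₂ (i , p)) → Fin.suc i , p })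
  (λ { (inj₁ _) → refl ; (inj₂ _) → refl })
  (λ { (Fin.zero , _) → refl ; (Fin.suc _ , _) → refl })

Σ-ℕ↔ : {P : ℕ → Set} → Σ ℕ P ↔ (P zero ⊎ Σ ℕ (P ∘ suc))
Σ-ℕ↔ = mk↔ₛ′
  (λ { (zero , p) → inj₁ p ; (suc a , p) → inj₂ (a , p) })
  (λ { (inj₁ p) → zero , p ; (inj₂ (a , p)) → suc a , p })
  (λ { (inj₁ _) → refl ; (inj₂ _) → refl })
  (λ { (zero , _) → refl ; (suc _ , _) → refl })

∃-≡↔ : {P : ℕ → Set} → (∃ λ b → b ≡ n × P b) ↔ P n
∃-≡↔ = mk↔ₛ′ (λ { (_ , refl , p) → p }) (λ p → _ , refl , p) (λ _ → refl) (λ { (_ , refl , _) → refl })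

Antidiagonal : (ℕ → ℕ → Set) → ℕ → Set
Antidiagonal C n = Σ ℕ λ a → Σ ℕ λ b → a + b ≡ n × C a b

Antidiagonal-cong : {C D : ℕ → ℕ → Set} →
  (∀ a b → a + b ≡ n → C a b ↔ D a b) → Antidiagonal C n ↔ Antidiagonal D n
Antidiagonal-cong f = Σ-cong λ {a} → Σ-cong λ {b} → Σ-cong λ {e} → f a b e

map-applyUpTo : (h : A → B) (g : ℕ → A) (k : ℕ) → map h (applyUpTo g k) ≡ applyUpTo (h ∘ g) k
map-applyUpTo h g zero    = refl
map-applyUpTo h g (suc k) = cong (h (g 0) ∷_) (map-applyUpTo h (g ∘ suc) k)

Antidiagonal-Fin↔sum : (f : ℕ → ℕ → ℕ) (n : ℕ) →
  Antidiagonal (λ a b → Fin (f a b)) n ↔ Fin (sum (applyUpTo (λ i → f i (n ∸ i)) (suc n)))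
Antidiagonal-Fin↔sum f n = begin
  Antidiagonal (λ a b → Fin (f a b)) n
    ↔⟨ Σ-ℕ↔ ⟩
  ((∃ λ b → b ≡ n × Fin (f 0 b)) ⊎ (∃ λ a → ∃ λ b → suc a + b ≡ n × Fin (f (suc a) b)))
    ↔⟨ ⊎-cong ∃-≡↔ (positivePart n) ⟩
  (Fin (f 0 n) ⊎ Fin (sum (applyUpTo (λ i → f (suc i) (n ∸ suc i)) n)))
    ↔⟨ +↔⊎ ⟨
  Fin (sum (applyUpTo (λ i → f i (n ∸ i)) (suc n)))
    ∎
  where
  open EquationalReasoning

  positivePart : (n : ℕ) →
    (∃ λ a → ∃ λ b → suc a + b ≡ n × Fin (f (suc a) b)) ↔
    Fin (sum (applyUpTo (λ i → f (suc i) (n ∸ suc i)) n))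
  positivePart zero    = mk↔ₛ′ (λ { (_ , _ , () , _) }) (λ ()) (λ ()) (λ { (_ , _ , () , _) })
  positivePart (suc n) =
    ↔-trans (Σ-cong (Σ-cong (×-cong suc≡suc↔ ↔-refl))) (Antidiagonal-Fin↔sum (f ∘ suc) n)

Sized : (FBT → Set) → ℕ → Set
Sized X n = Σ FBT λ T → internals T ≡ n × X T

Sized-cong : {X Y : FBT → Set} → (∀ T → internals T ≡ n → X T ↔ Y T) → Sized X n ↔ Sized Y n
Sized-cong f = Σ-cong λ {T} → Σ-cong λ {e} → f T e

Sized-zero↔ : {X : FBT → Set} → Sized X 0 ↔ X leaf
Sized-zero↔ {X} = mk↔ₛ′ atLeaf (λ x → leaf , refl , x) (λ _ → refl) (λ { (leaf , refl , _) → refl })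
  where
  atLeaf : Sized X 0 → X leaf
  atLeaf (leaf , _ , x) = x

Sized-suc↔ : {X : FBT → Set} →
  Sized X (suc n) ↔ Antidiagonal (λ a b → Sized (λ L → Sized (λ R → X (node L R)) b) a) n
Sized-suc↔ {n} {X} = mk↔ₛ′ split join split∘join join∘split
  where
  split : Sized X (suc n) → Antidiagonal (λ a b → Sized (λ L → Sized (λ R → X (node L R)) b) a) n
  split (node L R , e , x) = _ , _ , suc-injective e , L , refl , R , refl , x

  join : Antidiagonal (λ a b → Sized (λ L → Sized (λ R → X (node L R)) b) a) n → Sized X (suc n)
  join (_ , _ , e , L , refl , R , refl , x) = node L R , cong suc e , x

  split∘join : ∀ y → split (join y) ≡ y
  split∘join (_ , _ , e , L , refl , R , refl , x) =
    cong (λ e′ → _ , _ , e′ , L , refl , R , refl , x) (≡-irrelevant _ e)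

  join∘split : ∀ y → join (split y) ≡ y
  join∘split (node L R , e , x) = cong (λ e′ → node L R , e′ , x) (≡-irrelevant _ e)

Sized-×↔ : {X Y : FBT → Set} →
  Sized (λ L → Sized (λ R → X L × Y R) b) a ↔ (Sized X a × Sized Y b)
Sized-×↔ = mk↔ₛ′
  (λ (L , eL , R , eR , x , y) → (L , eL , x) , (R , eR , y))
  (λ ((L , eL , x) , (R , eR , y)) → L , eL , R , eR , x , y)
  (λ _ → refl) (λ _ → refl)

-- Pointer choices for the leaves of w when the sink and t internal nodes precede w:
-- a leaf preceded by j internal nodes of w has t + j + 1 possible targets.
Choices : ℕ → List Bool → Set
Choices t []          = ⊤
Choices t (true ∷ w)  = Choices (suc t) w
Choices t (false ∷ w) = Fin (suc t) × Choices t w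

trues : List Bool → ℕ
trues []          = 0
trues (true ∷ w)  = suc (trues w)
trues (false ∷ w) = trues w

trues-++ : (xs ys : List Bool) → trues (xs ++ ys) ≡ trues xs + trues ys
trues-++ []           ys = refl
trues-++ (true ∷ xs)  ys = cong suc (trues-++ xs ys)
trues-++ (false ∷ xs) ys = trues-++ xs ys

trues-postorder : (T : FBT) → trues (postorder T) ≡ internals T
trues-postorder leaf       = refl
trues-postorder (node L R) = begin
  trues (postorder L ++ postorder R ++ [ true ])
    ≡⟨ trues-++ (postorder L) _ ⟩
  trues (postorder L) + trues (postorder R ++ [ true ])
    ≡⟨ cong (trues (postorder L) +_) (trues-++ (postorder R) _) ⟩
  trues (postorder L) + (trues (postorder R) + 1)
    ≡⟨ cong₂ (λ l r → l + (r + 1)) (trues-postorder L) (trues-postorder R) ⟩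
  internals L + (internals R + 1)
    ≡⟨ cong (internals L +_) (+-comm (internals R) 1) ⟩
  internals L + suc (internals R)
    ≡⟨ +-suc (internals L) (internals R) ⟩
  suc (internals L + internals R)
    ∎
  where open ≡-Reasoning

Choices-≡ : {s t : ℕ} (w : List Bool) → s ≡ t → Choices s w ↔ Choices t w
Choices-≡ w e = K-reflexive (cong (λ s → Choices s w) e)

Choices-++↔ : (t : ℕ) (xs ys : List Bool) →
  Choices t (xs ++ ys) ↔ (Choices t xs × Choices (t + trues xs) ys)
Choices-++↔ t []           ys = ↔-trans (Choices-≡ ys (sym (+-identityʳ t))) (↔-sym ⊤-×↔)
Choices-++↔ t (true ∷ xs)  ys =
  ↔-trans (Choices-++↔ (suc t) xs ys) (×-cong ↔-refl (Choices-≡ ys (sym (+-suc t (trues xs)))))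
Choices-++↔ t (false ∷ xs) ys = ↔-trans (×-cong ↔-refl (Choices-++↔ t xs ys)) (↔-sym Σ-assoc)

Choices-node↔ : (t : ℕ) (L R : FBT) →
  Choices t (postorder (node L R)) ↔ (Choices t (postorder L) × Choices (t + internals L) (postorder R))
Choices-node↔ t L R = begin
  Choices t (postorder L ++ postorder R ++ [ true ])
    ↔⟨ Choices-++↔ t (postorder L) _ ⟩
  (Choices t (postorder L) × Choices (t + trues (postorder L)) (postorder R ++ [ true ]))
    ↔⟨ ×-cong ↔-refl (Choices-++↔ _ (postorder R) _) ⟩
  (Choices t (postorder L) × (Choices (t + trues (postorder L)) (postorder R) × ⊤))
    ↔⟨ ×-cong ↔-refl (↔-trans ×-⊤↔ (Choices-≡ (postorder R) (cong (t +_) (trues-postorder L)))) ⟩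
  (Choices t (postorder L) × Choices (t + internals L) (postorder R))
    ∎
  where open EquationalReasoning

Decorated : ℕ → ℕ → Set
Decorated t = Sized (Choices t ∘ postorder)

Decorated-zero↔ : Decorated t 0 ↔ Fin (suc t)
Decorated-zero↔ = ↔-trans Sized-zero↔ ×-⊤↔

Decorated-suc↔ : Decorated t (suc n) ↔ Antidiagonal (λ a b → Decorated t a × Decorated (t + a) b) n
Decorated-suc↔ {t} = ↔-trans Sized-suc↔ (Antidiagonal-cong λ a b _ →
  ↔-trans (Sized-cong λ L eL → Sized-cong λ R _ →
             ↔-trans (Choices-node↔ t L R) (×-cong ↔-refl (Choices-≡ (postorder R) (cong (t +_) eL))))
          Sized-×↔)

Decorated↔δ-fuel : (f n t : ℕ) → n ≤ f → Decorated t n ↔ Fin (δ-fuel f n t)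
Decorated↔δ-fuel f       zero    t _         = Decorated-zero↔
Decorated↔δ-fuel (suc f) (suc n) t (s≤s n≤f) = begin
  Decorated t (suc n)
    ↔⟨ Decorated-suc↔ ⟩
  Antidiagonal (λ a b → Decorated t a × Decorated (t + a) b) n
    ↔⟨ Antidiagonal-cong (λ a b a+b≡n → ↔-trans
         (×-cong (Decorated↔δ-fuel f a t (≤-trans (m+n≤o⇒m≤o a (≤-reflexive a+b≡n)) n≤f))
                 (Decorated↔δ-fuel f b (t + a) (≤-trans (m+n≤o⇒n≤o a (≤-reflexive a+b≡n)) n≤f)))
         (↔-sym *↔×)) ⟩
  Antidiagonal (λ a b → Fin (δ-fuel f a t * δ-fuel f b (t + a))) n
    ↔⟨ Antidiagonal-Fin↔sum (λ a b → δ-fuel f a t * δ-fuel f b (t + a)) n ⟩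
  Fin (sum (applyUpTo (λ i → δ-fuel f i t * δ-fuel f (n ∸ i) (t + i)) (suc n)))
    ≡⟨ cong (Fin ∘ sum) (sym (map-applyUpTo _ (λ i → i) (suc n))) ⟩
  Fin (δ-fuel (suc f) (suc n) t)
    ∎
  where open EquationalReasoning

hasLeaf-++ : (xs ys : List Bool) → hasLeaf xs ≡ true → hasLeaf (xs ++ ys) ≡ true
hasLeaf-++ (true ∷ xs)  ys h = hasLeaf-++ xs ys h
hasLeaf-++ (false ∷ xs) ys _ = refl

Internal : List Bool → Set
Internal pre = Σ (Fin (length pre)) λ j → lookup pre j ≡ true

Internal↔Fin : (pre : List Bool) → Internal pre ↔ Fin (trues pre)
Internal↔Fin []            = mk↔ₛ′ (λ { (() , _) }) (λ ()) (λ ()) (λ { (() , _) })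
Internal↔Fin (true ∷ pre)  =
  ↔-trans Σ-Fin-suc↔ (↔-trans (⊎-cong true≡true↔⊤ (Internal↔Fin pre)) (↔-sym Fin-suc↔))
Internal↔Fin (false ∷ pre) =
  ↔-trans Σ-Fin-suc↔ (↔-trans (⊎-emptyˡ (λ ())) (Internal↔Fin pre))

Target↔Fin : (pre : List Bool) → hasLeaf pre ≡ true → Target pre ↔ Fin (suc (trues pre))
Target↔Fin (true ∷ pre)  h = ↔-trans Σ-Fin-suc↔
  (↔-trans (⊎-cong (↔-trans (⊎-emptyʳ (λ ())) true≡true↔⊤) (Target↔Fin pre h)) (↔-sym Fin-suc↔))
Target↔Fin (false ∷ pre) _ = ↔-trans Σ-Fin-suc↔
  (↔-trans (⊎-cong (⊎-emptyˡ (λ ())) (↔-trans (Σ-cong (⊎-emptyʳ (λ ()))) (Internal↔Fin pre))) (↔-sym Fin-suc↔))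

Pointers↔Choices : (pre w : List Bool) → hasLeaf pre ≡ true → Pointers pre w ↔ Choices (trues pre) w
Pointers↔Choices pre []          _ = ↔-refl
Pointers↔Choices pre (true ∷ w)  h =
  ↔-trans (Pointers↔Choices (pre ++ [ true ]) w (hasLeaf-++ pre _ h))
          (Choices-≡ w (trans (trues-++ pre _) (+-comm (trues pre) 1)))
Pointers↔Choices pre (false ∷ w) h rewrite h = ×-cong (Target↔Fin pre h)
  (↔-trans (Pointers↔Choices (pre ++ [ false ]) w (hasLeaf-++ pre _ h))
           (Choices-≡ w (trans (trues-++ pre _) (+-identityʳ (trues pre)))))

postorder-startsWithLeaf : (T : FBT) → ∃ λ w → postorder T ≡ false ∷ w
postorder-startsWithLeaf leaf       = [] , refl
postorder-startsWithLeaf (node L R) with postorder-startsWithLeaf L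
... | w , e = w ++ postorder R ++ [ true ] , cong (_++ postorder R ++ [ true ]) e

-- In Choices 0 the sink gets a single choice (Fin 1), matching its having no pointer.
Pointers-fromSink↔ : (T : FBT) → Pointers [] (postorder T) ↔ Choices 0 (postorder T)
Pointers-fromSink↔ T with postorder-startsWithLeaf T
... | w , e rewrite e =
  ↔-trans (Pointers↔Choices [ false ] w refl) (↔-sym (↔-trans (×-cong 1↔⊤ ↔-refl) ⊤-×↔))

mainTheorem5 : (n : ℕ) → RelaxedTree n ↔ Fin (δ n 0)
mainTheorem5 n = ↔-trans (Sized-cong λ T _ → Pointers-fromSink↔ T) (Decorated↔δ-fuel n n 0 ≤-refl)
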